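{- Let $G$ be a graph, $(T,\chi)$ a lenient tree decomposition of $G$, and $G^+$ the $(T,\chi)$-completion of $G$. Then $G^+$ is chordal.
   Context: Lenient tree decomposition: $(T,\chi)$, $T$ a tree, $\chi:V(T)\to 2^{V(G)}$, with (C1) bags covering $V(G)$; (C2) every edge $e$ of $G$ satisfies $e\subseteq\chi(t)\cup\chi(t')$ for some close nodes $t,t'$ (equal or adjacent); (C3) $\{t:x\in\chi(t)\}$ is connected in $T$ for every $x$. The $(T,\chi)$-completion of $G$ is the graph $G^+$ on $V(G)$ whose edge set is $\bigcup\binom{\chi(t)\cup\chi(t')}{2}$ over all close pairs $t,t'$ of nodes of $T$. A graph is chordal if all its induced cycles are triangles. -}

module Defs where

open import Data.Nat using (ℕ; suc; _+_)
open import Data.Fin using (Fin; toℕ)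
open import Data.Product using (Σ; _×_; ∃; ∃-syntax)
open import Data.Sum using (_⊎_)
open import Data.Unit using (⊤)
open import Relation.Nullary using (¬_)
open import Relation.Binary.PropositionalEquality using (_≡_; _≢_)
open import Function.Definitions using (Injective)

record Graph (n : ℕ) : Set₁ where
  field
    E      : Fin n → Fin n → Set
    E-sym  : ∀ {x y} → E x y → E y x
    E-irr  : ∀ {x} → ¬ E x x
open Graph public

CycSucc : ∀ {k} → Fin k → Fin k → Set
CycSucc {k} i j = (toℕ j ≡ suc (toℕ i)) ⊎ ((suc (toℕ i) ≡ k) × (toℕ j ≡ 0))

IsCycle : ∀ {n} (E : Fin n → Fin n → Set) (l : ℕ) → (Fin (3 + l) → Fin n) → Set
IsCycle E l c = Injective _≡_ _≡_ c × (∀ i j → CycSucc i j → E (c i) (c j))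

IsInducedCycle : ∀ {n} (E : Fin n → Fin n → Set) (l : ℕ) → (Fin (3 + l) → Fin n) → Set
IsInducedCycle E l c = IsCycle E l c × (∀ i j → E (c i) (c j) → CycSucc i j ⊎ CycSucc j i)

Chordal : ∀ {n} → (Fin n → Fin n → Set) → Set
Chordal {n} E = ∀ (l : ℕ) (c : Fin (3 + l) → Fin n) → IsInducedCycle E l c → l ≡ 0

data WalkIn {m : ℕ} (A : Fin m → Fin m → Set) (S : Fin m → Set) : Fin m → Fin m → Set where
  here : ∀ {x} → S x → WalkIn A S x x
  step : ∀ {x y z} → S x → A x y → WalkIn A S y z → WalkIn A S x z

ConnectedSet : ∀ {m} → (Fin m → Fin m → Set) → (Fin m → Set) → Set
ConnectedSet A S = ∀ s t → S s → S t → WalkIn A S s t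

record IsTree {m : ℕ} (T : Graph m) : Set where
  field
    connected : ConnectedSet (E T) (λ _ → ⊤)
    acyclic   : ∀ (l : ℕ) (c : Fin (3 + l) → Fin m) → ¬ IsCycle (E T) l c

Close : ∀ {m} → Graph m → Fin m → Fin m → Set
Close T t t' = (t ≡ t') ⊎ E T t t'

record IsLenientTD {n m : ℕ} (G : Graph n) (T : Graph m) (χ : Fin m → Fin n → Set) : Set where
  field
    tree : IsTree T
    C1   : ∀ x → ∃[ t ] χ t x
    C2   : ∀ x y → E G x y → ∃[ t ] ∃[ t' ] (Close T t t' × (χ t x ⊎ χ t' x) × (χ t y ⊎ χ t' y))
    C3   : ∀ x → ConnectedSet (E T) (λ t → χ t x)

Completion : ∀ {n m} → Graph m → (Fin m → Fin n → Set) → Fin n → Fin n → Set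
Completion T χ x y = (x ≢ y) × ∃[ t ] ∃[ t' ] (Close T t t' × (χ t x ⊎ χ t' x) × (χ t y ⊎ χ t' y))

-- Let c₀ c₁ … c_k (k ≥ 3) be an induced cycle of G⁺. As c₀ and c₂ are not adjacent in G⁺, no two
-- close nodes carry them, so a tree path from a bag of c₀ to a bag of c₂ passes through a node w
-- containing neither; by (C3) all bags of c₀ lie in one component of T − w and some bag of c₂ lies
-- in another. An edge xy of G⁺ with y ∉ χ(w) cannot leave the component containing the bags of x.
-- Hence c₁ ∈ χ(w) (otherwise c₀ c₁ c₂ drags c₂ along), so no cᵢ with i ≥ 3 is in χ(w) (it would
-- form a chord with c₁), and then c₀ c_k … c₂ drags c₂ along after all.

module Submission where

open import Data.Nat using (ℕ; zero; suc; _+_)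
open import Data.Nat.Properties using (suc-injective)
open import Data.Fin using (Fin; zero; suc; toℕ; fromℕ; inject₁)
open import Data.Fin.Properties using (_≟_; toℕ-fromℕ; toℕ-inject₁)
open import Data.Fin.Induction using (>-weakInduction)
open import Data.Product using (∃-syntax; _×_; _,_; proj₁; proj₂)
open import Data.Sum using (_⊎_; inj₁; inj₂; [_,_]′)
open import Data.Unit using (⊤; tt)
open import Data.Empty using (⊥; ⊥-elim)
open import Relation.Nullary using (¬_; yes; no)
open import Relation.Nullary.Decidable using (¬¬-excluded-middle)
open import Relation.Binary.PropositionalEquality
open import Defs

module Walks {m : ℕ} (A : Fin m → Fin m → Set) where

  _++ʷ_ : ∀ {S x y z} → WalkIn A S x y → WalkIn A S y z → WalkIn A S x z
  here _ ++ʷ q = q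
  step s e p ++ʷ q = step s e (p ++ʷ q)

  weaken : ∀ {S Q : Fin m → Set} {x y} → (∀ {v} → S v → Q v) → WalkIn A S x y → WalkIn A Q x y
  weaken f (here s) = here (f s)
  weaken f (step s e p) = step (f s) e (weaken f p)

  _∈ʷ_ : ∀ {S x y} → Fin m → WalkIn A S x y → Set
  v ∈ʷ here {x} _ = v ≡ x
  v ∈ʷ step {x} _ _ p = v ≡ x ⊎ v ∈ʷ p

  start-∈ʷ : ∀ {S x y} (p : WalkIn A S x y) → x ∈ʷ p
  start-∈ʷ (here _) = refl
  start-∈ʷ (step _ _ _) = inj₁ refl

  restrict : ∀ {S Q : Fin m → Set} {x y} (p : WalkIn A S x y) → (∀ {v} → v ∈ʷ p → Q v) → WalkIn A Q x y
  restrict (here _) f = here (f refl)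
  restrict (step _ e p) f = step (f (inj₁ refl)) e (restrict p (λ v∈p → f (inj₂ v∈p)))

  Simple : ∀ {S x y} → WalkIn A S x y → Set
  Simple (here _) = ⊤
  Simple (step {x} _ _ p) = ¬ x ∈ʷ p × Simple p

  simpleSuffixFrom : ∀ {S y z} v (p : WalkIn A S y z) → Simple p →
                     ¬ v ∈ʷ p ⊎ ∃[ q ] (Simple {S} {v} {z} q)
  simpleSuffixFrom {y = y} v (here s) _ with v ≟ y
  ... | yes refl = inj₂ (here s , tt)
  ... | no v≢y = inj₁ v≢y
  simpleSuffixFrom {y = y} v (step s e p) simple@(_ , simple-p) with v ≟ y
  ... | yes refl = inj₂ (step s e p , simple)
  ... | no v≢y with simpleSuffixFrom v p simple-p
  ...   | inj₁ v∉p = inj₁ [ v≢y , v∉p ]′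
  ...   | inj₂ suffix = inj₂ suffix

  simplify : ∀ {S x y} → WalkIn A S x y → ∃[ q ] (Simple {S} {x} {y} q)
  simplify (here s) = here s , tt
  simplify {x = x} (step s e p) with simplify p
  ... | q , simple-q with simpleSuffixFrom x q simple-q
  ...   | inj₁ x∉q = step s e q , x∉q , simple-q
  ...   | inj₂ suffix = suffix

  length : ∀ {S x y} → WalkIn A S x y → ℕ
  length (here _) = 0
  length (step _ _ p) = suc (length p)

  vertex : ∀ {S x y} (p : WalkIn A S x y) → Fin (suc (length p)) → Fin m
  vertex (here {x} _) _ = x
  vertex (step {x} _ _ p) zero = x
  vertex (step _ _ p) (suc i) = vertex p i

  vertex-start : ∀ {S x y} (p : WalkIn A S x y) → vertex p zero ≡ x
  vertex-start (here _) = refl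
  vertex-start (step _ _ _) = refl

  vertex-end : ∀ {S x y} (p : WalkIn A S x y) i → toℕ i ≡ length p → vertex p i ≡ y
  vertex-end (here _) zero _ = refl
  vertex-end (step _ _ p) (suc i) eq = vertex-end p i (suc-injective eq)

  vertex-support : ∀ {S x y} (p : WalkIn A S x y) i → S (vertex p i)
  vertex-support (here s) _ = s
  vertex-support (step s _ p) zero = s
  vertex-support (step _ _ p) (suc i) = vertex-support p i

  vertex-∈ʷ : ∀ {S x y} (p : WalkIn A S x y) i → vertex p i ∈ʷ p
  vertex-∈ʷ (here _) _ = refl
  vertex-∈ʷ (step _ _ p) zero = inj₁ refl
  vertex-∈ʷ (step _ _ p) (suc i) = inj₂ (vertex-∈ʷ p i)

  vertex-injective : ∀ {S x y} (p : WalkIn A S x y) → Simple p → ∀ i j → vertex p i ≡ vertex p j → i ≡ j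
  vertex-injective (here _) _ zero zero _ = refl
  vertex-injective (step _ _ p) _ zero zero _ = refl
  vertex-injective (step _ _ p) (x∉p , _) zero (suc j) eq =
    ⊥-elim (x∉p (subst (_∈ʷ p) (sym eq) (vertex-∈ʷ p j)))
  vertex-injective (step _ _ p) (x∉p , _) (suc i) zero eq =
    ⊥-elim (x∉p (subst (_∈ʷ p) eq (vertex-∈ʷ p i)))
  vertex-injective (step _ _ p) (_ , simple-p) (suc i) (suc j) eq =
    cong suc (vertex-injective p simple-p i j eq)

  vertex-adjacent : ∀ {S x y} (p : WalkIn A S x y) i j → toℕ j ≡ suc (toℕ i) → A (vertex p i) (vertex p j)
  vertex-adjacent (step _ e p) zero (suc zero) _ = subst (A _) (sym (vertex-start p)) e
  vertex-adjacent (step _ e p) (suc i) (suc j) eq = vertex-adjacent p i j (suc-injective eq)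

  commonNeighbour⇒cycle : ∀ {w u v} → A w u → A v w → (q : WalkIn A (_≢ w) u v) → Simple q → u ≢ v →
                          ∃[ l ] ∃[ c ] IsCycle A l c
  commonNeighbour⇒cycle _ _ (here _) _ u≢u = ⊥-elim (u≢u refl)
  commonNeighbour⇒cycle {w} wu vw q@(step _ _ q′) simple-q _ = length q′ , c , c-injective , c-adjacent
    where
      c : Fin (3 + length q′) → Fin m
      c zero = w
      c (suc i) = vertex q i

      c-injective : ∀ {i j} → c i ≡ c j → i ≡ j
      c-injective {zero} {zero} _ = refl
      c-injective {zero} {suc j} eq = ⊥-elim (vertex-support q j (sym eq))
      c-injective {suc i} {zero} eq = ⊥-elim (vertex-support q i eq)
      c-injective {suc i} {suc j} eq = cong suc (vertex-injective q simple-q i j eq)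

      c-adjacent : ∀ i j → CycSucc i j → A (c i) (c j)
      c-adjacent zero (suc zero) (inj₁ _) = subst (A w) (sym (vertex-start q)) wu
      c-adjacent (suc i) (suc j) (inj₁ eq) = vertex-adjacent q i j (suc-injective eq)
      c-adjacent (suc i) zero (inj₂ (eq , _)) =
        subst (λ z → A z w) (sym (vertex-end q i (suc-injective (suc-injective eq)))) vw

module Trees {m : ℕ} {T : Graph m} (tree : IsTree T) where
  open Walks (E T)

  noWalkAvoidingCommonNeighbour : ∀ {w u v} → E T w u → E T w v → u ≢ v → ¬ WalkIn (E T) (_≢ w) u v
  noWalkAvoidingCommonNeighbour wu wv u≢v p with simplify p
  ... | q , simple-q with commonNeighbour⇒cycle wu (E-sym T wv) q simple-q u≢v
  ...   | l , c , cycle = IsTree.acyclic tree l c cycle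

  edgeThenSimplePath-separates : ∀ {S s w t} → E T s w → (q : WalkIn (E T) S w t) → Simple q → ¬ s ∈ʷ q →
                                 t ≢ w → ¬ WalkIn (E T) (_≢ w) t s
  edgeThenSimplePath-separates _ (here _) _ _ w≢w _ = w≢w refl
  edgeThenSimplePath-separates {s = s} {w = w} {t = t} sw (step {y = u} _ wu q′) (w∉q′ , _) s∉q _ back =
    noWalkAvoidingCommonNeighbour wu (E-sym T sw) u≢s (q′-avoiding-w ++ʷ back)
    where
      u≢s : u ≢ s
      u≢s u≡s = s∉q (inj₂ (subst (_∈ʷ q′) u≡s (start-∈ʷ q′)))
      q′-avoiding-w : WalkIn (E T) (_≢ w) u t
      q′-avoiding-w = restrict q′ (λ {v} v∈q′ v≡w → w∉q′ (subst (_∈ʷ q′) v≡w v∈q′))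

module Bags {n m : ℕ} {T : Graph m} (χ : Fin m → Fin n → Set) (tree : IsTree T)
            (covering : ∀ x → ∃[ t ] χ t x) (connected : ∀ x → ConnectedSet (E T) (λ t → χ t x)) where
  open Walks (E T)
  open Trees tree

  close-sym : ∀ {t t′} → Close T t t′ → Close T t′ t
  close-sym (inj₁ refl) = inj₁ refl
  close-sym (inj₂ e) = inj₂ (E-sym T e)

  BagsClose : Fin n → Fin n → Set
  BagsClose x y = ∃[ t ] ∃[ t′ ] (Close T t t′ × χ t x × χ t′ y)

  completion⇒bagsClose : ∀ {x y} → Completion T χ x y → BagsClose x y
  completion⇒bagsClose (_ , t , t′ , cl , inj₁ x∈t , inj₁ y∈t) = t , t , inj₁ refl , x∈t , y∈t
  completion⇒bagsClose (_ , t , t′ , cl , inj₁ x∈t , inj₂ y∈t′) = t , t′ , cl , x∈t , y∈t′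
  completion⇒bagsClose (_ , t , t′ , cl , inj₂ x∈t′ , inj₁ y∈t) = t′ , t , close-sym cl , x∈t′ , y∈t
  completion⇒bagsClose (_ , t , t′ , cl , inj₂ x∈t′ , inj₂ y∈t′) = t′ , t′ , inj₁ refl , x∈t′ , y∈t′

  completion-sym : ∀ {x y} → Completion T χ x y → Completion T χ y x
  completion-sym (x≢y , t , t′ , cl , x∈ , y∈) = (λ y≡x → x≢y (sym y≡x)) , t , t′ , cl , y∈ , x∈

  bagsClose⇒completion : ∀ {x y} → x ≢ y → BagsClose x y → Completion T χ x y
  bagsClose⇒completion x≢y (t , t′ , cl , x∈t , y∈t′) = x≢y , t , t′ , cl , inj₁ x∈t , inj₂ y∈t′

  bag≢ : ∀ {w t x} → ¬ χ w x → χ t x → t ≢ w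
  bag≢ {x = x} x∉w x∈t t≡w = x∉w (subst (λ z → χ z x) t≡w x∈t)

  Component : Fin m → Fin m → Fin m → Set
  Component w s v = WalkIn (E T) (_≢ w) v s

  component-close : ∀ {w s t t′} → Close T t t′ → t′ ≢ w → Component w s t → Component w s t′
  component-close (inj₁ refl) _ walk = walk
  component-close (inj₂ e) t′≢w walk = step t′≢w (E-sym T e) walk

  Confined : Fin m → Fin m → Fin n → Set
  Confined w s x = ∀ t → χ t x → Component w s t

  confined-fromBag : ∀ {w s t x} → ¬ χ w x → χ t x → Component w s t → Confined w s x
  confined-fromBag {t = t} {x = x} x∉w x∈t walk t′ x∈t′ =
    weaken (bag≢ x∉w) (connected x t′ t x∈t′ x∈t) ++ʷ walk

  confined-step : ∀ {w s x y} → Completion T χ x y → ¬ χ w y → Confined w s x → Confined w s y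
  confined-step xy y∉w x-confined with completion⇒bagsClose xy
  ... | t , t′ , cl , x∈t , y∈t′ =
    confined-fromBag y∉w y∈t′ (component-close cl (bag≢ y∉w y∈t′) (x-confined t x∈t))

  record Separator (x y : Fin n) : Set where
    field
      {cut bagˣ bagʸ} : Fin m
      x∈bagˣ : χ bagˣ x
      y∈bagʸ : χ bagʸ y
      x∉cut  : ¬ χ cut x
      y∉cut  : ¬ χ cut y
      apart  : ¬ Component cut bagˣ bagʸ

    x-confined : Confined cut bagˣ x
    x-confined = confined-fromBag x∉cut x∈bagˣ (here (bag≢ x∉cut x∈bagˣ))

    y-unconfined : ¬ Confined cut bagˣ y
    y-unconfined y-confined = apart (y-confined bagʸ y∈bagʸ)

  -- The cut is the first node of the path that contains neither x nor y; bag membership is not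
  -- decidable, hence the double negation.
  separatorAlong : ∀ {S s t x y} → ¬ BagsClose x y → (p : WalkIn (E T) S s t) → Simple p →
                   χ s x → χ t y → ¬ ¬ Separator x y
  separatorAlong ¬close (here _) _ x∈s y∈s _ = ¬close (_ , _ , inj₁ refl , x∈s , y∈s)
  separatorAlong ¬close (step _ su rest) (s∉rest , simple-rest) x∈s y∈t noSeparator =
    ¬¬-excluded-middle λ
      { (yes x∈u) → separatorAlong ¬close rest simple-rest x∈u y∈t noSeparator
      ; (no x∉u) → ¬¬-excluded-middle λ
          { (yes y∈u) → ¬close (_ , _ , inj₂ su , x∈s , y∈u)
          ; (no y∉u) → noSeparator record
              { x∈bagˣ = x∈s ; y∈bagʸ = y∈t ; x∉cut = x∉u ; y∉cut = y∉u
              ; apart = edgeThenSimplePath-separates su rest simple-rest s∉rest (bag≢ y∉u y∈t) } } }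

  separator : ∀ {x y} → ¬ BagsClose x y → ¬ ¬ Separator x y
  separator {x} {y} ¬close with covering x | covering y
  ... | s , x∈s | t , y∈t with simplify (IsTree.connected tree s t tt tt)
  ...   | p , simple-p = separatorAlong ¬close p simple-p x∈s y∈t

  module LongInducedCycle {l : ℕ} {c : Fin (4 + l) → Fin n}
                          (induced : IsInducedCycle (Completion T χ) (suc l) c) where
    private
      c-adjacent : ∀ i j → CycSucc i j → Completion T χ (c i) (c j)
      c-adjacent = proj₂ (proj₁ induced)

      closeBags⇒consecutive : ∀ {i j} → i ≢ j → BagsClose (c i) (c j) → CycSucc i j ⊎ CycSucc j i
      closeBags⇒consecutive {i} {j} i≢j close =
        proj₂ induced i j (bagsClose⇒completion (λ ci≡cj → i≢j (proj₁ (proj₁ induced) ci≡cj)) close)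

    c₀c₂-notClose : ¬ BagsClose (c zero) (c (suc (suc zero)))
    c₀c₂-notClose close with closeBags⇒consecutive (λ ()) close
    ... | inj₁ (inj₁ ())
    ... | inj₁ (inj₂ (() , _))
    ... | inj₂ (inj₁ ())
    ... | inj₂ (inj₂ (() , _))

    module Separated (sep : Separator (c zero) (c (suc (suc zero)))) where
      open Separator sep

      -- c₁ is G⁺-adjacent to both c₀ and c₂, so it cannot avoid the cut.
      cut-contains-c₁ : ¬ ¬ χ cut (c (suc zero))
      cut-contains-c₁ c₁∉cut = y-unconfined
        (confined-step (c-adjacent _ _ (inj₁ refl)) y∉cut
          (confined-step (c-adjacent _ _ (inj₁ refl)) c₁∉cut x-confined))

      laterOutsideCut : χ cut (c (suc zero)) → ∀ i → ¬ χ cut (c (suc (suc (suc i))))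
      laterOutsideCut c₁∈cut i c∈cut with closeBags⇒consecutive (λ ()) (cut , cut , inj₁ refl , c₁∈cut , c∈cut)
      ... | inj₁ (inj₁ ())
      ... | inj₁ (inj₂ (() , _))
      ... | inj₂ (inj₁ ())
      ... | inj₂ (inj₂ (_ , ()))

      path : Fin (2 + l) → Fin n
      path k = c (suc (suc k))

      pathOutsideCut : χ cut (c (suc zero)) → ∀ k → ¬ χ cut (path k)
      pathOutsideCut _ zero = y∉cut
      pathOutsideCut c₁∈cut (suc i) = laterOutsideCut c₁∈cut i

      -- Walk back from c₀ through the closing edge and then down the indices to c₂.
      pathConfined : χ cut (c (suc zero)) → ∀ k → Confined cut bagˣ (path k)
      pathConfined c₁∈cut = >-weakInduction (λ k → Confined cut bagˣ (path k)) lastConfined stepDown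
        where
          lastConfined : Confined cut bagˣ (path (fromℕ (suc l)))
          lastConfined = confined-step
            (completion-sym (c-adjacent _ zero (inj₂ (cong (3 +_) (toℕ-fromℕ (suc l)) , refl))))
            (pathOutsideCut c₁∈cut (fromℕ (suc l))) x-confined

          stepDown : ∀ i → Confined cut bagˣ (path (suc i)) → Confined cut bagˣ (path (inject₁ i))
          stepDown i = confined-step
            (completion-sym (c-adjacent _ _ (inj₁ (cong (3 +_) (sym (toℕ-inject₁ i))))))
            (pathOutsideCut c₁∈cut (inject₁ i))

      absurd : ⊥
      absurd = cut-contains-c₁ (λ c₁∈cut → y-unconfined (pathConfined c₁∈cut zero))

    absurd : ⊥
    absurd = separator c₀c₂-notClose Separated.absurd

mainTheorem16 : ∀ {n m : ℕ} (G : Graph n) (T : Graph m) (χ : Fin m → Fin n → Set)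
    → IsLenientTD G T χ → Chordal (Completion T χ)
mainTheorem16 G T χ td zero c _ = refl
mainTheorem16 G T χ td (suc l) c induced = ⊥-elim (LongInducedCycle.absurd induced)
  where
    open IsLenientTD td
    open Bags χ tree C1 C3
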